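{- Let $n$ and $t$ be integers with $1\leq t\leq \frac{n-1}{2}$, let $k$ be a positive integer, and let $G=G(n;\{1,2,\ldots,t\})$ be the circulant graph on vertex set $\mathbb{Z}_n$ in which distinct vertices $i,j$ are adjacent if and only if $\min\{|i-j|,\,n-|i-j|\}\in\{1,2,\ldots,t\}$ (equivalently, $G=C_n^t$, the $t$-th power of the cycle $C_n$). Then the integer $\{k\}$-domination number of $G$ satisfies $$\gamma_k(G)=\left\lceil \frac{kn}{2t+1}\right\rceil.$$
   Context: For a simple graph $G$, a function $f:V(G)\to\mathbb{N}\cup\{0\}$ is an integer $\{k\}$-domination function if $\sum_{u\in N_G[v]}f(u)\geq k$ for every $v\in V(G)$, where $N_G[v]$ is the closed neighborhood of $v$. The integer $\{k\}$-domination number $\gamma_k(G)$ is the minimum of $\sum_{v\in V(G)}f(v)$ over all integer $\{k\}$-domination functions $f$ of $G$. -}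

module Defs where

open import Data.Nat using (ℕ; zero; suc; _+_; _*_; _∸_; _≤_; _<_; _⊓_; ∣_-_∣; _/_)
open import Data.Fin using (Fin; toℕ)
open import Data.Product using (_×_; Σ)
open import Data.Bool using (Bool; true; false; if_then_else_; _∧_)
open import Relation.Nullary using (¬_)
open import Relation.Nullary.Decidable using (⌊_⌋)
open import Relation.Binary.PropositionalEquality using (_≡_)
import Data.Nat as ℕ

ΣFin : (n : ℕ) → (Fin n → ℕ) → ℕ
ΣFin zero    f = 0
ΣFin (suc n) f = f Fin.zero + ΣFin n (λ i → f (Fin.suc i))
  where import Data.Fin as Fin

AdjRel : ℕ → Set
AdjRel n = Fin n → Fin n → Bool

inClosedNbhd : ∀ {n} → AdjRel n → Fin n → Fin n → Bool
inClosedNbhd G v u = if ⌊ toℕ u ℕ.≟ toℕ v ⌋ then true else G v u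

closedNbhdSum : ∀ {n} → AdjRel n → (Fin n → ℕ) → Fin n → ℕ
closedNbhdSum {n} G f v = ΣFin n (λ u → if inClosedNbhd G v u then f u else 0)

weight : ∀ {n} → (Fin n → ℕ) → ℕ
weight {n} f = ΣFin n f

IsKDomFun : ∀ {n} → AdjRel n → ℕ → (Fin n → ℕ) → Set
IsKDomFun G k f = ∀ v → k ≤ closedNbhdSum G f v

IsKDomNumber : ∀ {n} → AdjRel n → ℕ → ℕ → Set
IsKDomNumber G k m =
  Σ _ (λ f → IsKDomFun G k f × weight f ≡ m)
  × (∀ f → IsKDomFun G k f → m ≤ weight f)

circDist : (n : ℕ) → Fin n → Fin n → ℕ
circDist n i j = ∣ toℕ i - toℕ j ∣ ⊓ (n ∸ ∣ toℕ i - toℕ j ∣)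

circAdj : (n t : ℕ) → Fin n → Fin n → Bool
circAdj n t i j = ⌊ 1 ℕ.≤? circDist n i j ⌋ ∧ ⌊ circDist n i j ℕ.≤? t ⌋

circulant : (n t : ℕ) → AdjRel n
circulant = circAdj

-- ⌈ a / b ⌉ for b = suc c > 0
ceilDiv : ℕ → (c : ℕ) → ℕ
ceilDiv a c = (a + c) / suc c

-- The closed neighbourhood of
-- a vertex is a window of 2t + 1 consecutive vertices, and every vertex lies in
-- exactly 2t + 1 windows.  Summing the domination condition over all n vertices
-- therefore gives k n ≤ (2t + 1) · weight f, the lower bound.  For the upper
-- bound, put W = ⌈kn/(2t+1)⌉ and spread weight W as evenly as possible:
-- f(x) = ⌊(x+1)W/n⌋ − ⌊xW/n⌋.  The weight telescopes to W, and a window starting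
-- at c telescopes to ⌊(c + 2t + 1)W/n⌋ − ⌊cW/n⌋ ≥ ⌊(cW + kn)/n⌋ − ⌊cW/n⌋ = k.
module Submission where

open import Data.Bool using (if_then_else_; _∧_)
open import Data.Fin using (Fin; toℕ)
import Data.Fin as Fin
open import Data.Fin.Properties using (toℕ-injective; toℕ-fromℕ<; toℕ<n)
open import Data.Nat
open import Data.Nat.Properties
open import Data.Nat.DivMod
open import Data.Nat.Divisibility using (n∣m*n)
open import Data.Nat.Tactic.RingSolver using (solve-∀)
open import Data.Product using (_,_)
open import Function using (_∘_)
open import Relation.Nullary using (yes; no)
open import Relation.Nullary.Decidable using (⌊_⌋; isYes≗does; dec-true; dec-false)
open import Relation.Binary.PropositionalEquality
open import Defs

sumTo : ℕ → (ℕ → ℕ) → ℕ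
sumTo zero    h = 0
sumTo (suc n) h = sumTo n h + h n

sumTo-cong : ∀ n {h h′ : ℕ → ℕ} → (∀ i → i < n → h i ≡ h′ i) → sumTo n h ≡ sumTo n h′
sumTo-cong zero    eq = refl
sumTo-cong (suc n) eq = cong₂ _+_ (sumTo-cong n (λ i i<n → eq i (m≤n⇒m≤1+n i<n))) (eq n ≤-refl)

sumTo-const : ∀ n k → sumTo n (λ _ → k) ≡ n * k
sumTo-const zero    k = refl
sumTo-const (suc n) k = trans (cong (_+ k) (sumTo-const n k)) (+-comm (n * k) k)

sumTo-suc : ∀ n h → sumTo (suc n) h ≡ h 0 + sumTo n (h ∘ suc)
sumTo-suc zero    h = +-comm 0 (h 0)
sumTo-suc (suc n) h = trans (cong (_+ h (suc n)) (sumTo-suc n h)) (+-assoc (h 0) _ _)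

sumTo-distrib-+ : ∀ n h h′ → sumTo n (λ i → h i + h′ i) ≡ sumTo n h + sumTo n h′
sumTo-distrib-+ zero    h h′ = refl
sumTo-distrib-+ (suc n) h h′ = trans (cong (_+ (h n + h′ n)) (sumTo-distrib-+ n h h′))
  (interchange (sumTo n h) (sumTo n h′) (h n) (h′ n))
  where
  interchange : ∀ a b c d → (a + b) + (c + d) ≡ (a + c) + (b + d)
  interchange = solve-∀

sumTo-comm : ∀ n m (h : ℕ → ℕ → ℕ) →
  sumTo n (λ i → sumTo m (h i)) ≡ sumTo m (λ j → sumTo n (λ i → h i j))
sumTo-comm zero    m h = sym (trans (sumTo-const m 0) (*-zeroʳ m))
sumTo-comm (suc n) m h = trans (cong (_+ sumTo m (h n)) (sumTo-comm n m h))
  (sym (sumTo-distrib-+ m (λ j → sumTo n (λ i → h i j)) (h n)))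

sumTo-+ : ∀ m p h → sumTo (m + p) h ≡ sumTo m h + sumTo p (λ i → h (m + i))
sumTo-+ m zero    h = trans (cong (λ l → sumTo l h) (+-identityʳ m)) (sym (+-identityʳ _))
sumTo-+ m (suc p) h = begin
  sumTo (m + suc p) h                               ≡⟨ cong (λ l → sumTo l h) (+-suc m p) ⟩
  sumTo (m + p) h + h (m + p)                       ≡⟨ cong (_+ h (m + p)) (sumTo-+ m p h) ⟩
  sumTo m h + sumTo p (λ i → h (m + i)) + h (m + p) ≡⟨ +-assoc (sumTo m h) _ _ ⟩
  sumTo m h + sumTo (suc p) (λ i → h (m + i))       ∎
  where open ≡-Reasoning

sumTo-shift : ∀ n h → h n ≡ h 0 → sumTo n (h ∘ suc) ≡ sumTo n h
sumTo-shift zero    h _          = refl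
sumTo-shift (suc n) h wrap-around = begin
  sumTo n (h ∘ suc) + h (suc n)  ≡⟨ cong (sumTo n (h ∘ suc) +_) wrap-around ⟩
  sumTo n (h ∘ suc) + h 0        ≡⟨ +-comm _ (h 0) ⟩
  h 0 + sumTo n (h ∘ suc)        ≡⟨ sumTo-suc n h ⟨
  sumTo (suc n) h                ∎
  where open ≡-Reasoning

sumTo-rotate : ∀ n h c → (∀ i → h (i + n) ≡ h i) → sumTo n (λ j → h (c + j)) ≡ sumTo n h
sumTo-rotate n h zero    periodic = refl
sumTo-rotate n h (suc c) periodic = begin
  sumTo n (λ j → h (suc c + j))  ≡⟨ sumTo-cong n (λ j _ → cong h (sym (+-suc c j))) ⟩
  sumTo n (λ j → h (c + suc j))  ≡⟨ sumTo-shift n (λ j → h (c + j)) (trans (periodic c) (cong h (sym (+-identityʳ c)))) ⟩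
  sumTo n (λ j → h (c + j))      ≡⟨ sumTo-rotate n h c periodic ⟩
  sumTo n h                      ∎
  where open ≡-Reasoning

sumTo-telescope : ∀ (S : ℕ → ℕ) → (∀ x → S x ≤ S (suc x)) → ∀ c m →
  S c + sumTo m (λ j → S (suc (c + j)) ∸ S (c + j)) ≡ S (c + m)
sumTo-telescope S mono c zero    = trans (+-identityʳ _) (cong S (sym (+-identityʳ c)))
sumTo-telescope S mono c (suc m) = begin
  S c + (sumTo m Δ + Δ m)                ≡⟨ +-assoc (S c) _ _ ⟨
  S c + sumTo m Δ + Δ m                  ≡⟨ cong (_+ Δ m) (sumTo-telescope S mono c m) ⟩
  S (c + m) + (S (suc (c + m)) ∸ S (c + m)) ≡⟨ m+[n∸m]≡n (mono (c + m)) ⟩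
  S (suc (c + m))                        ≡⟨ cong S (+-suc c m) ⟨
  S (c + suc m)                          ∎
  where
  open ≡-Reasoning
  Δ : ℕ → ℕ
  Δ j = S (suc (c + j)) ∸ S (c + j)

ΣFin≡sumTo : ∀ n (f : Fin n → ℕ) (h : ℕ → ℕ) → (∀ u → h (toℕ u) ≡ f u) → ΣFin n f ≡ sumTo n h
ΣFin≡sumTo zero    f h eq = refl
ΣFin≡sumTo (suc n) f h eq = trans
  (cong₂ _+_ (sym (eq Fin.zero)) (ΣFin≡sumTo n (f ∘ Fin.suc) (h ∘ suc) (eq ∘ Fin.suc)))
  (sym (sumTo-suc n h))

ΣFin-mono-≤ : ∀ n (f g : Fin n → ℕ) → (∀ u → f u ≤ g u) → ΣFin n f ≤ ΣFin n g
ΣFin-mono-≤ zero    f g le = z≤n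
ΣFin-mono-≤ (suc n) f g le = +-mono-≤ (le Fin.zero) (ΣFin-mono-≤ n _ _ (le ∘ Fin.suc))

ceilDiv-spec : ∀ a c → a ≤ suc c * ceilDiv a c
ceilDiv-spec a c = +-cancelʳ-≤ c a (suc c * q) (begin
  a + c                        ≡⟨ m≡m%n+[m/n]*n (a + c) (suc c) ⟩
  (a + c) % suc c + q * suc c  ≤⟨ +-monoˡ-≤ (q * suc c) (s≤s⁻¹ (m%n<n (a + c) (suc c))) ⟩
  c + q * suc c                ≡⟨ +-comm c _ ⟩
  q * suc c + c                ≡⟨ cong (_+ c) (*-comm q (suc c)) ⟩
  suc c * q + c                ∎)
  where
  open ≤-Reasoning
  q : ℕ
  q = ceilDiv a c

ceilDiv-least : ∀ a c w → a ≤ suc c * w → ceilDiv a c ≤ w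
ceilDiv-least a c w a≤ = s≤s⁻¹ (m<n*o⇒m/o<n (begin-strict
  a + c              <⟨ +-monoʳ-< a (n<1+n c) ⟩
  a + suc c          ≤⟨ +-monoˡ-≤ (suc c) a≤ ⟩
  suc c * w + suc c  ≡⟨ cong (_+ suc c) (*-comm (suc c) w) ⟩
  w * suc c + suc c  ≡⟨ +-comm (w * suc c) (suc c) ⟩
  suc w * suc c      ∎))
  where open ≤-Reasoning

module Cycle (n : ℕ) .{{_ : NonZero n}} where

  wrap : ℕ → Fin n
  wrap y = y mod n

  toℕ-wrap : ∀ y → toℕ (wrap y) ≡ y % n
  toℕ-wrap y = toℕ-fromℕ< (m%n<n y n)

  wrap-toℕ : ∀ u → wrap (toℕ u) ≡ u
  wrap-toℕ u = toℕ-injective (trans (toℕ-wrap (toℕ u)) (m<n⇒m%n≡m (toℕ<n u)))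

  wrap-+n : ∀ y → wrap (y + n) ≡ wrap y
  wrap-+n y = toℕ-injective (trans (toℕ-wrap (y + n)) (trans ([m+n]%n≡m%n y n) (sym (toℕ-wrap y))))

  ΣFin-rotate : ∀ (f : Fin n → ℕ) c → sumTo n (λ j → f (wrap (c + j))) ≡ ΣFin n f
  ΣFin-rotate f c = trans (sumTo-rotate n (f ∘ wrap) c (cong f ∘ wrap-+n))
    (sym (ΣFin≡sumTo n f (f ∘ wrap) (cong f ∘ wrap-toℕ)))

  -- circDist n i j is definitionally arc ∣ toℕ i - toℕ j ∣.
  arc : ℕ → ℕ
  arc z = z ⊓ (n ∸ z)

  arc-reflect : ∀ {z} → z ≤ n → arc (n ∸ z) ≡ arc z
  arc-reflect {z} z≤n′ = trans (cong ((n ∸ z) ⊓_) (m∸[m∸n]≡n z≤n′)) (⊓-comm (n ∸ z) z)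

  arc-shift : ∀ x r → x < n → r < n → arc ∣ x - (x + r) % n ∣ ≡ arc r
  arc-shift x r x<n r<n with x + r <? n
  ... | yes x+r<n = begin
    arc ∣ x - (x + r) % n ∣  ≡⟨ cong (arc ∘ ∣ x -_∣) (m<n⇒m%n≡m x+r<n) ⟩
    arc ∣ x - x + r ∣        ≡⟨ cong arc (∣m-m+n∣≡n x r) ⟩
    arc r                    ∎
    where open ≡-Reasoning
  ... | no x+r≮n = begin
    arc ∣ x - (x + r) % n ∣  ≡⟨ cong (arc ∘ ∣ x -_∣) [x+r]%n≡y ⟩
    arc ∣ x - y ∣            ≡⟨ cong (λ z → arc ∣ z - y ∣) y+[n∸r]≡x ⟨
    arc ∣ y + (n ∸ r) - y ∣  ≡⟨ cong arc (trans (∣-∣-comm _ y) (∣m-m+n∣≡n y (n ∸ r))) ⟩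
    arc (n ∸ r)              ≡⟨ arc-reflect (<⇒≤ r<n) ⟩
    arc r                    ∎
    where
    open ≡-Reasoning
    n≤x+r : n ≤ x + r
    n≤x+r = ≮⇒≥ x+r≮n
    y : ℕ
    y = x + r ∸ n
    [x+r]%n≡y : (x + r) % n ≡ y
    [x+r]%n≡y = begin
      (x + r) % n  ≡⟨ cong (_% n) (m∸n+n≡m n≤x+r) ⟨
      (y + n) % n  ≡⟨ [m+n]%n≡m%n y n ⟩
      y % n        ≡⟨ m<n⇒m%n≡m (m<n+o⇒m∸n<o (x + r) n (+-mono-< x<n r<n)) ⟩
      y            ∎
    y+[n∸r]≡x : y + (n ∸ r) ≡ x
    y+[n∸r]≡x = +-cancelʳ-≡ r _ _ (begin
      y + (n ∸ r) + r  ≡⟨ +-assoc y (n ∸ r) r ⟩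
      y + (n ∸ r + r)  ≡⟨ cong (y +_) (m∸n+n≡m (<⇒≤ r<n)) ⟩
      y + n            ≡⟨ m∸n+n≡m n≤x+r ⟩
      x + r            ∎)

  circDist-wrap : ∀ (a : Fin n) s → circDist n a (wrap (toℕ a + s)) ≡ arc (s % n)
  circDist-wrap a s = begin
    arc ∣ x - toℕ (wrap (x + s)) ∣   ≡⟨ cong (λ z → arc ∣ x - z ∣) (toℕ-wrap (x + s)) ⟩
    arc ∣ x - (x + s) % n ∣          ≡⟨ cong (λ z → arc ∣ x - (x + z) % n ∣) (m≡m%n+[m/n]*n s n) ⟩
    arc ∣ x - (x + (r + q * n)) % n ∣ ≡⟨ cong (λ z → arc ∣ x - z % n ∣) (+-assoc x r _) ⟨
    arc ∣ x - (x + r + q * n) % n ∣  ≡⟨ cong (λ z → arc ∣ x - z ∣) ([m+kn]%n≡m%n (x + r) q n) ⟩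
    arc ∣ x - (x + r) % n ∣          ≡⟨ arc-shift x r (toℕ<n a) (m%n<n s n) ⟩
    arc r                            ∎
    where
    open ≡-Reasoning
    x r q : ℕ
    x = toℕ a
    r = s % n
    q = s / n

inClosedNbhd-circulant : ∀ n t (v u : Fin n) →
  inClosedNbhd (circulant n t) v u ≡ ⌊ circDist n v u ≤? t ⌋
inClosedNbhd-circulant n t v u with toℕ u ≟ toℕ v
... | yes u≡v rewrite u≡v | ∣n-n∣≡0 (toℕ v) = refl
... | no u≢v = cong (_∧ ⌊ circDist n v u ≤? t ⌋) (trans (isYes≗does (1 ≤? _)) (dec-true (1 ≤? _) 1≤d))
  where
  1≤d : 1 ≤ circDist n v u
  1≤d = ⊓-glb (n≢0⇒n>0 (u≢v ∘ sym ∘ ∣m-n∣≡0⇒m≡n))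
              (m<n⇒0<n∸m (≤-<-trans (∣m-n∣≤m⊔n (toℕ v) (toℕ u)) (⊔-lub (toℕ<n v) (toℕ<n u))))

module Staircase (n W : ℕ) .{{_ : NonZero n}} where
  open Cycle n

  level : ℕ → ℕ
  level x = x * W / n

  level-mono : ∀ x → level x ≤ level (suc x)
  level-mono x = /-monoˡ-≤ n (*-monoˡ-≤ W (n≤1+n x))

  level-+kn : ∀ x q → level (x + q * n) ≡ level x + q * W
  level-+kn x q = begin
    (x + q * n) * W / n      ≡⟨ cong (_/ n) (*-distribʳ-+ W x (q * n)) ⟩
    (x * W + q * n * W) / n  ≡⟨ cong (λ z → (x * W + z) / n) (swap q n W) ⟩
    (x * W + q * W * n) / n  ≡⟨ +-distrib-/-∣ʳ (x * W) (n∣m*n (q * W)) ⟩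
    level x + q * W * n / n  ≡⟨ cong (level x +_) (m*n/n≡m (q * W) n) ⟩
    level x + q * W          ∎
    where
    open ≡-Reasoning
    swap : ∀ a b c → a * b * c ≡ a * c * b
    swap = solve-∀

  step : ℕ → ℕ
  step x = level (suc x) ∸ level x

  step-+kn : ∀ x q → step (x + q * n) ≡ step x
  step-+kn x q = trans (cong₂ _∸_ (level-+kn (suc x) q) (level-+kn x q))
    (trans (cong₂ _∸_ (+-comm (level (suc x)) (q * W)) (+-comm (level x) (q * W)))
      ([m+n]∸[m+o]≡n∸o (q * W) (level (suc x)) (level x)))

  staircase : Fin n → ℕ
  staircase u = step (toℕ u)

  staircase-wrap : ∀ y → staircase (wrap y) ≡ step y
  staircase-wrap y = begin
    step (toℕ (wrap y))      ≡⟨ cong step (toℕ-wrap y) ⟩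
    step (y % n)             ≡⟨ step-+kn (y % n) (y / n) ⟨
    step (y % n + y / n * n) ≡⟨ cong step (m≡m%n+[m/n]*n y n) ⟨
    step y                   ∎
    where open ≡-Reasoning

  weight-staircase : weight staircase ≡ W
  weight-staircase = begin
    weight staircase    ≡⟨ ΣFin≡sumTo n staircase step (λ _ → refl) ⟩
    sumTo n step        ≡⟨ cong (_+ sumTo n step) (0/n≡0 n) ⟨
    level 0 + sumTo n step ≡⟨ sumTo-telescope level level-mono 0 n ⟩
    n * W / n           ≡⟨ cong (_/ n) (*-comm n W) ⟩
    W * n / n           ≡⟨ m*n/n≡m W n ⟩
    W                   ∎
    where open ≡-Reasoning

  k≤sumTo-step : ∀ k m c → k * n ≤ m * W → k ≤ sumTo m (λ j → step (c + j))
  k≤sumTo-step k m c kn≤mW = +-cancelˡ-≤ (level c) k _ (begin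
    level c + k                    ≡⟨ cong (level c +_) (m*n/n≡m k n) ⟨
    level c + k * n / n            ≡⟨ +-distrib-/-∣ʳ (c * W) (n∣m*n k) ⟨
    (c * W + k * n) / n            ≤⟨ /-monoˡ-≤ n (+-monoʳ-≤ (c * W) kn≤mW) ⟩
    (c * W + m * W) / n            ≡⟨ cong (_/ n) (*-distribʳ-+ W c m) ⟨
    level (c + m)                  ≡⟨ sumTo-telescope level level-mono c m ⟨
    level c + sumTo m (λ j → step (c + j)) ∎)
    where open ≤-Reasoning

module CirculantPower (n t : ℕ) .{{_ : NonZero n}} (2t<n : suc (2 * t) ≤ n) where
  open Cycle n

  window-size : ℕ
  window-size = suc (2 * t)

  start : Fin n → ℕ
  start a = toℕ a + (n ∸ t)

  window : Fin n → ℕ → Fin n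
  window a j = wrap (start a + j)

  t≤n : t ≤ n
  t≤n = ≤-trans (m≤m+n t (t + 0)) (<⇒≤ 2t<n)

  2*t≡t+t : 2 * t ≡ t + t
  2*t≡t+t = cong (t +_) (+-identityʳ t)

  offset : ℕ → ℕ
  offset j = (n ∸ t + j) % n

  offset-≥ : ∀ {j} → t ≤ j → j < n → offset j ≡ j ∸ t
  offset-≥ {j} t≤j j<n = begin
    (n ∸ t + j) % n   ≡⟨ cong (_% n) (+-comm (n ∸ t) j) ⟩
    (j + (n ∸ t)) % n ≡⟨ cong (_% n) (+-∸-assoc j t≤n) ⟨
    (j + n ∸ t) % n   ≡⟨ cong (_% n) (+-∸-comm n t≤j) ⟩
    (j ∸ t + n) % n   ≡⟨ [m+n]%n≡m%n (j ∸ t) n ⟩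
    (j ∸ t) % n       ≡⟨ m<n⇒m%n≡m (≤-<-trans (m∸n≤m j t) j<n) ⟩
    j ∸ t             ∎
    where open ≡-Reasoning

  arc-offset-≤ : ∀ j → j ≤ 2 * t → arc (offset j) ≤ t
  arc-offset-≤ j j≤2t with j <? t
  ... | yes j<t = begin
    arc (offset j)        ≤⟨ m⊓n≤n _ _ ⟩
    n ∸ offset j          ≡⟨ cong (n ∸_) (m<n⇒m%n≡m n∸t+j<n) ⟩
    n ∸ (n ∸ t + j)       ≤⟨ ∸-monoʳ-≤ n (m≤m+n (n ∸ t) j) ⟩
    n ∸ (n ∸ t)           ≡⟨ m∸[m∸n]≡n t≤n ⟩
    t                     ∎
    where
    open ≤-Reasoning
    n∸t+j<n : n ∸ t + j < n
    n∸t+j<n = subst (n ∸ t + j <_) (m∸n+n≡m t≤n) (+-monoʳ-< (n ∸ t) j<t)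
  ... | no j≮t = begin
    arc (offset j)        ≤⟨ m⊓n≤m _ _ ⟩
    offset j              ≡⟨ offset-≥ (≮⇒≥ j≮t) (≤-<-trans j≤2t 2t<n) ⟩
    j ∸ t                 ≤⟨ m≤n+o⇒m∸n≤o j t (subst (j ≤_) 2*t≡t+t j≤2t) ⟩
    t                     ∎
    where open ≤-Reasoning

  arc-offset-> : ∀ j → 2 * t < j → j < n → t < arc (offset j)
  arc-offset-> j 2t<j j<n = subst (λ z → t < z ⊓ (n ∸ z)) (sym (offset-≥ t≤j j<n)) (⊓-glb t<j∸t t<n∸[j∸t])
    where
    t≤j : t ≤ j
    t≤j = ≤-trans (m≤m+n t (t + 0)) (<⇒≤ 2t<j)
    t<j∸t : t < j ∸ t
    t<j∸t = m+n≤o⇒m≤o∸n (suc t) (subst (_< j) 2*t≡t+t 2t<j)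
    t<n∸[j∸t] : t < n ∸ (j ∸ t)
    t<n∸[j∸t] = m+n≤o⇒m≤o∸n (suc t) (subst (_< n) (sym (m+[n∸m]≡n t≤j)) j<n)

  inClosedNbhd-window : ∀ a j → inClosedNbhd (circulant n t) a (window a j) ≡ ⌊ arc (offset j) ≤? t ⌋
  inClosedNbhd-window a j = begin
    inClosedNbhd (circulant n t) a (window a j)       ≡⟨ inClosedNbhd-circulant n t a (window a j) ⟩
    ⌊ circDist n a (window a j) ≤? t ⌋                ≡⟨ cong (λ u → ⌊ circDist n a (wrap u) ≤? t ⌋) (+-assoc (toℕ a) (n ∸ t) j) ⟩
    ⌊ circDist n a (wrap (toℕ a + (n ∸ t + j))) ≤? t ⌋ ≡⟨ cong (λ d → ⌊ d ≤? t ⌋) (circDist-wrap a (n ∸ t + j)) ⟩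
    ⌊ arc (offset j) ≤? t ⌋                           ∎
    where open ≡-Reasoning

  closedNbhdSum≡window : ∀ f a → closedNbhdSum (circulant n t) f a ≡ sumTo window-size (f ∘ window a)
  closedNbhdSum≡window f a = begin
    closedNbhdSum (circulant n t) f a                ≡⟨ ΣFin-rotate term (start a) ⟨
    sumTo n (term ∘ window a)                        ≡⟨ cong (λ l → sumTo l (term ∘ window a)) (m+[n∸m]≡n 2t<n) ⟨
    sumTo (window-size + (n ∸ window-size)) (term ∘ window a)
      ≡⟨ sumTo-+ window-size (n ∸ window-size) (term ∘ window a) ⟩
    sumTo window-size (term ∘ window a) + sumTo (n ∸ window-size) (λ i → term (window a (window-size + i)))
      ≡⟨ cong₂ _+_ (sumTo-cong window-size inside) (sumTo-cong (n ∸ window-size) outside) ⟩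
    sumTo window-size (f ∘ window a) + sumTo (n ∸ window-size) (λ _ → 0)
      ≡⟨ cong (sumTo window-size (f ∘ window a) +_) (trans (sumTo-const (n ∸ window-size) 0) (*-zeroʳ (n ∸ window-size))) ⟩
    sumTo window-size (f ∘ window a) + 0             ≡⟨ +-identityʳ _ ⟩
    sumTo window-size (f ∘ window a)                 ∎
    where
    open ≡-Reasoning
    term : Fin n → ℕ
    term u = if inClosedNbhd (circulant n t) a u then f u else 0
    inside : ∀ j → j < window-size → term (window a j) ≡ f (window a j)
    inside j j<m = cong (λ b → if b then f (window a j) else 0)
      (trans (inClosedNbhd-window a j)
        (trans (isYes≗does (_ ≤? t)) (dec-true (_ ≤? t) (arc-offset-≤ j (s≤s⁻¹ j<m)))))
    outside : ∀ i → i < n ∸ window-size → term (window a (window-size + i)) ≡ 0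
    outside i i<n∸m = cong (λ b → if b then f (window a j) else 0)
      (trans (inClosedNbhd-window a j)
        (trans (isYes≗does (_ ≤? t)) (dec-false (_ ≤? t) (<⇒≱ (arc-offset-> j 2t<j j<n)))))
      where
      j : ℕ
      j = window-size + i
      2t<j : 2 * t < j
      2t<j = s≤s (m≤m+n (2 * t) i)
      j<n : j < n
      j<n = subst (j <_) (m+[n∸m]≡n 2t<n) (+-monoʳ-< window-size i<n∸m)

  weight-lower-bound : ∀ k f → IsKDomFun (circulant n t) k f → k * n ≤ window-size * weight f
  weight-lower-bound k f dom = begin
    k * n                                    ≡⟨ *-comm k n ⟩
    n * k                                    ≡⟨ sumTo-const n k ⟨
    sumTo n (λ _ → k)                        ≡⟨ ΣFin≡sumTo n _ _ (λ _ → refl) ⟨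
    ΣFin n (λ _ → k)                         ≤⟨ ΣFin-mono-≤ n _ _ dom ⟩
    ΣFin n (closedNbhdSum (circulant n t) f) ≡⟨ ΣFin≡sumTo n _ windowSum (sym ∘ closedNbhdSum≡window f) ⟩
    sumTo n windowSum                        ≡⟨ sumTo-comm n window-size _ ⟩
    sumTo window-size (λ j → sumTo n (λ y → f (wrap (y + (n ∸ t) + j))))
      ≡⟨ sumTo-cong window-size (λ j _ → translate-total j) ⟩
    sumTo window-size (λ _ → weight f)       ≡⟨ sumTo-const window-size (weight f) ⟩
    window-size * weight f                   ∎
    where
    open ≤-Reasoning
    windowSum : ℕ → ℕ
    windowSum y = sumTo window-size (λ j → f (wrap (y + (n ∸ t) + j)))
    translate-total : ∀ j → sumTo n (λ y → f (wrap (y + (n ∸ t) + j))) ≡ weight f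
    translate-total j = trans (sumTo-cong n (λ y _ → cong (f ∘ wrap) (reorder y))) (ΣFin-rotate f (n ∸ t + j))
      where
      reorder : ∀ y → y + (n ∸ t) + j ≡ n ∸ t + j + y
      reorder y = trans (+-assoc y (n ∸ t) j) (+-comm y _)

  staircase-dominating : ∀ k W → k * n ≤ window-size * W → IsKDomFun (circulant n t) k (Staircase.staircase n W)
  staircase-dominating k W kn≤mW a = subst (k ≤_) (begin
    sumTo window-size (λ j → step (start a + j))      ≡⟨ sumTo-cong window-size (λ j _ → staircase-wrap (start a + j)) ⟨
    sumTo window-size (staircase ∘ window a)          ≡⟨ closedNbhdSum≡window staircase a ⟨
    closedNbhdSum (circulant n t) staircase a         ∎)
    (k≤sumTo-step k window-size (start a) kn≤mW)
    where
    open Staircase n W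
    open ≡-Reasoning

theorem2p8 : (n t k : ℕ) → 1 ≤ t → 2 * t ≤ n ∸ 1 → 1 ≤ k →
    IsKDomNumber (circulant n t) k (ceilDiv (k * n) (2 * t))
theorem2p8 zero      zero    _ () _      _
theorem2p8 zero      (suc _) _ _  ()     _
theorem2p8 n@(suc _) t       k _  2t≤n-1 _ =
  (staircase , staircase-dominating k W (ceilDiv-spec (k * n) (2 * t)) , weight-staircase)
  , λ f dom → ceilDiv-least (k * n) (2 * t) (weight f) (weight-lower-bound k f dom)
  where
  W : ℕ
  W = ceilDiv (k * n) (2 * t)
  open CirculantPower n t (s≤s 2t≤n-1)
  open Staircase n W
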